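{- Let $n,m,k$ be positive integers with $m\le n$, and for an integer $t$ with $1\le t\le n$ define $$Q(k,m,t)=\sum_{i=0}^{t-m}(-1)^i\binom{t}{i}\binom{t-i}{m}^{k}$$ (the number of $k\times t$ $0$–$1$ matrices with exactly $m$ ones in each row and at least one $1$ in each column; empty sum $=0$ if $t<m$), and $$R(k,m,t)=\sum_{i=0}^{t-1}(-1)^i\binom{t}{i}(t-i)^{mk}.$$ Let $P=\left(\frac{n(n-1)\cdots(n-m+1)}{n^m}\right)^k$ be the probability that, when in each of $k$ independent stages $m$ nodes are chosen independently and uniformly (with repetition allowed) from a set of $n$ nodes, the $m$ chosen nodes are pairwise distinct in every stage. If $n,m,k\to\infty$ with $k\binom{m}{2}/n\to 0$, then for every $t$, $$\frac{\binom{n}{t}Q(k,m,t)}{\binom{n}{m}^{k}}\cdot P\le \frac{\binom{n}{t}R(k,m,t)}{n^{km}},$$ and $P\to 1$.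
   Context: Two allocation models over a set of $n$ nodes: $U_{n,k,\{m\}}$ consists of $k$ independent uniformly random $m$-element subsets of nodes (the left-hand side is the probability that their union has exactly $t$ nodes); $U_{n,k,m}$ consists of $k$ independent stages, each placing $m$ elements independently and uniformly on the $n$ nodes, giving $n^{km}$ equally likely ordered outcomes (the right-hand side is the probability that exactly $t$ distinct nodes are covered). -}

module Defs where

open import Data.Nat as ℕ using (ℕ; zero; suc; _∸_; _≤_)
open import Data.Nat.Combinatorics using (_C_; _P_)
open import Data.Integer as ℤ using (ℤ; +_; -_)
open import Data.Rational as ℚ using (ℚ; _/_; 0ℚ)

sumℤ : ℕ → (ℕ → ℤ) → ℤ
sumℤ zero    f = + 0
sumℤ (suc N) f = sumℤ N f ℤ.+ f N

sgn : ℕ → ℤ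
sgn i = (- (+ 1)) ℤ.^ i

-- Q(k,m,t) = Σ_{i=0}^{t-m} (-1)^i C(t,i) C(t-i,m)^k   (empty if t < m:
-- the number of terms is (t+1) ∸ m, which is 0 when t < m)
Q : ℕ → ℕ → ℕ → ℤ
Q k m t = sumℤ (suc t ∸ m)
  (λ i → sgn i ℤ.* (+ ((t C i) ℕ.* ((t ∸ i) C m) ℕ.^ k)))

R : ℕ → ℕ → ℕ → ℤ
R k m t = sumℤ t (λ i → sgn i ℤ.* (+ ((t C i) ℕ.* (t ∸ i) ℕ.^ (m ℕ.* k))))

-- a / d as a rational; only ever used with d ≥ 1 (the d = 0 branch is a
-- dummy convention that never arises under the hypotheses).
frac : ℤ → ℕ → ℚ
frac a zero    = 0ℚ
frac a (suc d) = a / suc d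

Pdist : ℕ → ℕ → ℕ → ℚ
Pdist n m k = frac (+ ((n P m) ℕ.^ k)) (n ℕ.^ (m ℕ.* k))

lhsFrac : ℕ → ℕ → ℕ → ℕ → ℚ
lhsFrac n m k t = frac (+ (n C t) ℤ.* Q k m t) ((n C m) ℕ.^ k)

rhsFrac : ℕ → ℕ → ℕ → ℕ → ℚ
rhsFrac n m k t = frac (+ (n C t) ℤ.* R k m t) (n ℕ.^ (k ℕ.* m))

TendsToInfty : (ℕ → ℕ) → Set
TendsToInfty a = ∀ (B : ℕ) → Σ' ℕ (λ J → ∀ j → J ≤ j → B ≤ a j)
  where
  open import Data.Product using () renaming (Σ to Σ')

TendsTo : (ℕ → ℚ) → ℚ → Set
TendsTo x L = ∀ (ε : ℚ) → 0ℚ ℚ.< ε →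
  Σ' ℕ (λ J → ∀ j → J ≤ j → ℚ.∣ x j ℚ.- L ∣ ℚ.< ε)
  where
  open import Data.Product using () renaming (Σ to Σ')

module Submission where

-- With (s)ₘ = s P m the falling factorial, Newton's formula identifies R(k,m,t) with the
-- t-th forward difference at 0 of s ↦ s ^ (m k), and Q(k,m,t) (m!) ^ k with that of
-- s ↦ (s)ₘ ^ k.  Call f : ℕ → ℤ absolutely monotone if all its forward differences are
-- nonnegative everywhere.  Such functions are closed under sums and, by the Leibniz rule
-- Δ(f g) = f(s+1) Δg + Δf g, under products; binomials s ↦ C(s,j) are absolutely
-- monotone, and by s ^ (m+1) − (s)ₘ₊₁ = s (s ^ m − (s)ₘ) + m (s)ₘ so is s ^ m − (s)ₘ.
-- Hence s ^ (m k) − (s)ₘ ^ k is absolutely monotone, giving Q (m!) ^ k ≤ R, and since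
-- P = C(n,m) ^ k (m!) ^ k / n ^ (m k) this is the inequality, for every n, m, k.
-- For the limit, n ^ m − (n)ₘ ≤ C(m,2) n ^ (m−1) and a Bernoulli-type estimate give
-- 0 ≤ 1 − P ≤ k C(m,2) / n.

open import Defs
open import Data.Nat as ℕ using (ℕ; zero; suc; _∸_; _!; z≤n; s≤s)
import Data.Nat.Properties as ℕP
open import Data.Nat.Combinatorics using (_C_; _P_; nCk+nC[k+1]≡[n+1]C[k+1]; k>n⇒nCk≡0; nCk≡nPk/k!; nC1≡n)
open import Data.Nat.Combinatorics.Base using (_P′_)
import Data.Nat.Combinatorics.Specification as Spec
open import Data.Nat.Divisibility using (_∣_)
open import Data.Nat.DivMod using (m/n*n≡m)
import Data.Nat.Tactic.RingSolver as ℕSolver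
open import Data.Sum using (inj₁; inj₂)
open import Relation.Nullary using (yes; no)
open import Data.Integer as ℤ using (ℤ; +_; -_; _+_; _-_; _*_; _^_; _≤_; 0ℤ)
import Data.Integer.Properties as ℤP
open import Data.Integer.Tactic.RingSolver using (solve-∀)
open import Data.Rational as ℚ using (toℚᵘ; 0ℚ; 1ℚ)
import Data.Rational.Properties as ℚP
import Data.Rational.Unnormalised as ℚᵘ
open ℚᵘ using (mkℚᵘ)
import Data.Rational.Unnormalised.Properties as ℚᵘP
open import Data.Product using (_×_; _,_)
open import Relation.Binary.PropositionalEquality

-- Falling factorials and binomial coefficients

nP′k≡0 : ∀ {n k} → n ℕ.< k → n P′ k ≡ 0
nP′k≡0 {n} {suc k} (s≤s n≤k) with ℕP.m≤n⇒m<n∨m≡n n≤k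
... | inj₁ n<k  = trans (cong ((n ∸ k) ℕ.*_) (nP′k≡0 n<k)) (ℕP.*-zeroʳ (n ∸ k))
... | inj₂ refl = cong (ℕ._* (n P′ n)) (ℕP.n∸n≡0 n)

nPk≡nP′k : ∀ n k → n P k ≡ n P′ k
nPk≡nP′k n k with k ℕP.≤? n
... | yes k≤n = trans (Spec.nPk≡n!/[n∸k]! k≤n) (sym (Spec.nP′k≡n!/[n∸k]! k≤n))
... | no  k≰n = trans (Spec.k>n⇒nPk≡0 (ℕP.≰⇒> k≰n)) (sym (nP′k≡0 (ℕP.≰⇒> k≰n)))

n*nPk≡nP[1+k]+k*nPk : ∀ n k → n ℕ.* (n P k) ≡ n P suc k ℕ.+ k ℕ.* (n P k)
n*nPk≡nP[1+k]+k*nPk n k rewrite nPk≡nP′k n k | nPk≡nP′k n (suc k) with k ℕP.≤? n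
... | yes k≤n = trans (cong (ℕ._* (n P′ k)) (sym (ℕP.m∸n+n≡m k≤n))) (ℕP.*-distribʳ-+ (n P′ k) (n ∸ k) k)
... | no  k≰n rewrite nP′k≡0 (ℕP.≰⇒> k≰n) | ℕP.*-zeroʳ n | ℕP.*-zeroʳ (n ∸ k) | ℕP.*-zeroʳ k = refl

nCk*k!≡nPk : ∀ n k → (n C k) ℕ.* k ! ≡ n P k
nCk*k!≡nPk n k with k ℕP.≤? n
... | yes k≤n = trans (cong (ℕ._* (k !)) (nCk≡nPk/k! k≤n))
                      (m/n*n≡m {{k ℕP.!≢0}} (subst (k ! ∣_) (sym (nPk≡nP′k n k)) (Spec.k!∣nP′k k≤n)))
... | no  k≰n rewrite k>n⇒nCk≡0 (ℕP.≰⇒> k≰n) | Spec.k>n⇒nPk≡0 (ℕP.≰⇒> k≰n) = refl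

1≤nP′k : ∀ {n k} → k ℕ.≤ n → 1 ℕ.≤ n P′ k
1≤nP′k {k = zero}  _   = s≤s z≤n
1≤nP′k {k = suc k} k<n = ℕP.*-mono-≤ (ℕP.m<n⇒0<n∸m k<n) (1≤nP′k (ℕP.<⇒≤ k<n))

1≤nCk : ∀ {n k} → k ℕ.≤ n → 1 ℕ.≤ n C k
1≤nCk {n} {k} k≤n = ℕ.>-nonZero⁻¹ (n C k) {{ℕP.m*n≢0⇒m≢0 (n C k) {{ℕ.>-nonZero 1≤nCk*k!}}}}
  where
  1≤nCk*k! : 1 ℕ.≤ (n C k) ℕ.* k !
  1≤nCk*k! = subst (1 ℕ.≤_) (sym (trans (nCk*k!≡nPk n k) (nPk≡nP′k n k))) (1≤nP′k k≤n)

nPk≤n^k : ∀ n k → n P k ℕ.≤ n ℕ.^ k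
nPk≤n^k n k = subst (ℕ._≤ n ℕ.^ k) (sym (nPk≡nP′k n k)) (nP′k≤n^k k)
  where
  nP′k≤n^k : ∀ k → n P′ k ℕ.≤ n ℕ.^ k
  nP′k≤n^k zero    = ℕP.≤-refl
  nP′k≤n^k (suc k) = ℕP.*-mono-≤ (ℕP.m∸n≤m n k) (nP′k≤n^k k)

[1+k]C2≡k+kC2 : ∀ k → suc k C 2 ≡ k ℕ.+ k C 2
[1+k]C2≡k+kC2 k = trans (sym (nCk+nC[k+1]≡[n+1]C[k+1] k 1)) (cong (ℕ._+ k C 2) (nC1≡n k))

[m*n]^k≡m^k*n^k : ∀ m n k → (m ℕ.* n) ℕ.^ k ≡ m ℕ.^ k ℕ.* n ℕ.^ k
[m*n]^k≡m^k*n^k m n zero    = refl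
[m*n]^k≡m^k*n^k m n (suc k) rewrite [m*n]^k≡m^k*n^k m n k = interchange m n (m ℕ.^ k) (n ℕ.^ k)
  where
  interchange : ∀ a b c d → a ℕ.* b ℕ.* (c ℕ.* d) ≡ a ℕ.* c ℕ.* (b ℕ.* d)
  interchange = ℕSolver.solve-∀

1≤m^n : ∀ {m} n → 1 ℕ.≤ m → 1 ℕ.≤ m ℕ.^ n
1≤m^n {m} n 1≤m = ℕP.m^n>0 m {{ℕ.>-nonZero 1≤m}} n

pos-^ : ∀ m k → + (m ℕ.^ k) ≡ (+ m) ^ k
pos-^ m zero    = refl
pos-^ m (suc k) = trans (ℤP.pos-* m (m ℕ.^ k)) (cong (+ m *_) (pos-^ m k))

-- Binomial transforms

sumℤ-cong : ∀ N {f g : ℕ → ℤ} → (∀ i → i ℕ.< N → f i ≡ g i) → sumℤ N f ≡ sumℤ N g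
sumℤ-cong zero    f≡g = refl
sumℤ-cong (suc N) f≡g =
  cong₂ _+_ (sumℤ-cong N (λ i i<N → f≡g i (ℕP.m<n⇒m<1+n i<N))) (f≡g N ℕP.≤-refl)

sumℤ-distrib-- : ∀ N (f g : ℕ → ℤ) → sumℤ N (λ i → f i - g i) ≡ sumℤ N f - sumℤ N g
sumℤ-distrib-- zero    f g = refl
sumℤ-distrib-- (suc N) f g rewrite sumℤ-distrib-- N f g = interchange (sumℤ N f) (sumℤ N g) (f N) (g N)
  where
  interchange : ∀ a b c d → a - b + (c - d) ≡ a + c - (b + d)
  interchange = solve-∀

sumℤ-distribˡ-* : ∀ N c (f : ℕ → ℤ) → sumℤ N (λ i → c * f i) ≡ c * sumℤ N f
sumℤ-distribˡ-* zero    c f = sym (ℤP.*-zeroʳ c)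
sumℤ-distribˡ-* (suc N) c f rewrite sumℤ-distribˡ-* N c f =
  sym (ℤP.*-distribˡ-+ c (sumℤ N f) (f N))

sumℤ-suc : ∀ N (f : ℕ → ℤ) → sumℤ (suc N) f ≡ f 0 + sumℤ N (λ i → f (suc i))
sumℤ-suc zero    f = ℤP.+-comm 0ℤ (f 0)
sumℤ-suc (suc N) f rewrite sumℤ-suc N f = ℤP.+-assoc (f 0) _ _

sumℤ-vanishing-tail : ∀ d N (f : ℕ → ℤ) → (∀ i → N ℕ.≤ i → f i ≡ 0ℤ) →
                      sumℤ (d ℕ.+ N) f ≡ sumℤ N f
sumℤ-vanishing-tail zero    N f f≡0 = refl
sumℤ-vanishing-tail (suc d) N f f≡0
  rewrite sumℤ-vanishing-tail d N f f≡0 | f≡0 (d ℕ.+ N) (ℕP.m≤n+m N d) = ℤP.+-identityʳ _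

signedBinomial : ℕ → ℕ → ℤ
signedBinomial t i = sgn i * + (t C i)

binomialTransform : ℕ → (ℕ → ℤ) → ℤ
binomialTransform t a = sumℤ (suc t) (λ i → signedBinomial t i * a i)

signedBinomial-suc : ∀ t i →
  signedBinomial (suc t) (suc i) ≡ signedBinomial t (suc i) - signedBinomial t i
signedBinomial-suc t i = begin
  - + 1 * sgn i * + (suc t C suc i)
    ≡⟨ cong (λ c → - + 1 * sgn i * + c) (sym (nCk+nC[k+1]≡[n+1]C[k+1] t i)) ⟩
  - + 1 * sgn i * + (t C i ℕ.+ t C suc i)
    ≡⟨ cong (- + 1 * sgn i *_) (ℤP.pos-+ (t C i) (t C suc i)) ⟩
  - + 1 * sgn i * (+ (t C i) + + (t C suc i))
    ≡⟨ pascal (sgn i) (+ (t C i)) (+ (t C suc i)) ⟩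
  - + 1 * sgn i * + (t C suc i) - sgn i * + (t C i) ∎
  where
  open ≡-Reasoning
  pascal : ∀ s a b → - + 1 * s * (a + b) ≡ - + 1 * s * b - s * a
  pascal = solve-∀

binomialTransform-cong : ∀ t {a b : ℕ → ℤ} → (∀ i → i ℕ.≤ t → a i ≡ b i) →
                         binomialTransform t a ≡ binomialTransform t b
binomialTransform-cong t a≡b =
  sumℤ-cong (suc t) (λ i i≤t → cong (signedBinomial t i *_) (a≡b i (ℕP.≤-pred i≤t)))

binomialTransform-distrib-- : ∀ t (a b : ℕ → ℤ) →
  binomialTransform t (λ i → a i - b i) ≡ binomialTransform t a - binomialTransform t b
binomialTransform-distrib-- t a b = begin
  sumℤ (suc t) (λ i → σ i * (a i - b i))        ≡⟨ sumℤ-cong (suc t) (λ i _ → distrib (σ i) (a i) (b i)) ⟩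
  sumℤ (suc t) (λ i → σ i * a i - σ i * b i)    ≡⟨ sumℤ-distrib-- (suc t) _ _ ⟩
  binomialTransform t a - binomialTransform t b ∎
  where
  open ≡-Reasoning
  σ = signedBinomial t
  distrib : ∀ s x y → s * (x - y) ≡ s * x - s * y
  distrib = solve-∀

binomialTransform-suc : ∀ t (a : ℕ → ℤ) →
  binomialTransform (suc t) a ≡ binomialTransform t a - binomialTransform t (λ i → a (suc i))
binomialTransform-suc t a = begin
  sumℤ (suc (suc t)) (λ i → signedBinomial (suc t) i * a i)
    ≡⟨ sumℤ-suc (suc t) _ ⟩
  σ 0 * a 0 + sumℤ (suc t) (λ i → signedBinomial (suc t) (suc i) * a (suc i))
    ≡⟨ cong (_+_ (σ 0 * a 0)) (sumℤ-cong (suc t) (λ i _ → pascal i)) ⟩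
  σ 0 * a 0 + sumℤ (suc t) (λ i → σ (suc i) * a (suc i) - σ i * a (suc i))
    ≡⟨ cong (_+_ (σ 0 * a 0)) (sumℤ-distrib-- (suc t) _ _) ⟩
  σ 0 * a 0 + (sumℤ (suc t) (λ i → σ (suc i) * a (suc i)) - B-shifted)
    ≡⟨ sym (ℤP.+-assoc (σ 0 * a 0) _ _) ⟩
  σ 0 * a 0 + sumℤ (suc t) (λ i → σ (suc i) * a (suc i)) - B-shifted
    ≡⟨ cong (_- B-shifted) (sym (sumℤ-suc (suc t) (λ i → σ i * a i))) ⟩
  binomialTransform t a + σ (suc t) * a (suc t) - B-shifted
    ≡⟨ cong (λ x → binomialTransform t a + x - B-shifted) last-vanishes ⟩
  binomialTransform t a + 0ℤ - B-shifted
    ≡⟨ cong (_- B-shifted) (ℤP.+-identityʳ (binomialTransform t a)) ⟩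
  binomialTransform t a - B-shifted ∎
  where
  open ≡-Reasoning
  σ = signedBinomial t
  B-shifted = binomialTransform t (λ i → a (suc i))
  pascal : ∀ i → signedBinomial (suc t) (suc i) * a (suc i) ≡ σ (suc i) * a (suc i) - σ i * a (suc i)
  pascal i = trans (cong (_* a (suc i)) (signedBinomial-suc t i)) (distribʳ (σ (suc i)) (σ i) (a (suc i)))
    where
    distribʳ : ∀ x y z → (x - y) * z ≡ x * z - y * z
    distribʳ = solve-∀
  last-vanishes : σ (suc t) * a (suc t) ≡ 0ℤ
  last-vanishes rewrite k>n⇒nCk≡0 (ℕP.n<1+n t) | ℤP.*-zeroʳ (sgn (suc t)) = refl

-- Forward differences

Δ : (ℕ → ℤ) → ℕ → ℤ
Δ f s = f (suc s) - f s

Δⁿ : ℕ → (ℕ → ℤ) → ℕ → ℤ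
Δⁿ zero    f = f
Δⁿ (suc t) f = Δⁿ t (Δ f)

Δⁿ-cong : ∀ t {f g : ℕ → ℤ} → (∀ s → f s ≡ g s) → ∀ s → Δⁿ t f s ≡ Δⁿ t g s
Δⁿ-cong zero    f≡g = f≡g
Δⁿ-cong (suc t) f≡g = Δⁿ-cong t (λ s → cong₂ _-_ (f≡g (suc s)) (f≡g s))

Δⁿ-+ : ∀ t (f g : ℕ → ℤ) s → Δⁿ t (λ s → f s + g s) s ≡ Δⁿ t f s + Δⁿ t g s
Δⁿ-+ zero    f g s = refl
Δⁿ-+ (suc t) f g s =
  trans (Δⁿ-cong t (λ s → interchange (f (suc s)) (g (suc s)) (f s) (g s)) s) (Δⁿ-+ t (Δ f) (Δ g) s)
  where
  interchange : ∀ a b c d → (a + b) - (c + d) ≡ (a - c) + (b - d)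
  interchange = solve-∀

Δⁿ-shift : ∀ t (f : ℕ → ℤ) s → Δⁿ t (λ s → f (suc s)) s ≡ Δⁿ t f (suc s)
Δⁿ-shift zero    f s = refl
Δⁿ-shift (suc t) f s = Δⁿ-shift t (Δ f) s

Δⁿ-zero : ∀ t s → Δⁿ t (λ _ → 0ℤ) s ≡ 0ℤ
Δⁿ-zero zero    s = refl
Δⁿ-zero (suc t) s = Δⁿ-zero t s

Δⁿ-newton : ∀ t (g : ℕ → ℤ) s → Δⁿ t g s ≡ binomialTransform t (λ i → g (s ℕ.+ (t ∸ i)))
Δⁿ-newton zero    g s = trans (cong g (sym (ℕP.+-identityʳ s))) (unit (g (s ℕ.+ 0)))
  where
  unit : ∀ x → x ≡ 0ℤ + + 1 * + 1 * x
  unit = solve-∀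
Δⁿ-newton (suc t) g s = begin
  Δⁿ t (Δ g) s
    ≡⟨ Δⁿ-newton t (Δ g) s ⟩
  binomialTransform t (λ i → g (suc (s ℕ.+ (t ∸ i))) - a (suc i))
    ≡⟨ binomialTransform-distrib-- t _ (λ i → a (suc i)) ⟩
  binomialTransform t (λ i → g (suc (s ℕ.+ (t ∸ i)))) - binomialTransform t (λ i → a (suc i))
    ≡⟨ cong (_- binomialTransform t (λ i → a (suc i)))
            (binomialTransform-cong t (λ i i≤t → cong g (index i≤t))) ⟩
  binomialTransform t a - binomialTransform t (λ i → a (suc i))
    ≡⟨ sym (binomialTransform-suc t a) ⟩
  binomialTransform (suc t) a ∎
  where
  open ≡-Reasoning
  a : ℕ → ℤ
  a i = g (s ℕ.+ (suc t ∸ i))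
  index : ∀ {i} → i ℕ.≤ t → suc (s ℕ.+ (t ∸ i)) ≡ s ℕ.+ (suc t ∸ i)
  index i≤t = trans (sym (ℕP.+-suc s _)) (cong (s ℕ.+_) (sym (ℕP.+-∸-assoc 1 i≤t)))

-- Absolutely monotone functions

i+[j-i]≡j : ∀ i j → i + (j - i) ≡ j
i+[j-i]≡j = solve-∀

i+j-j≡i : ∀ i j → i + j - j ≡ i
i+j-j≡i = solve-∀

0≤i*j : ∀ {i j} → 0ℤ ≤ i → 0ℤ ≤ j → 0ℤ ≤ i * j
0≤i*j {+ a} {+ b} _ _ = subst (0ℤ ≤_) (ℤP.pos-* a b) (ℤ.+≤+ z≤n)

AbsMonotone : (ℕ → ℤ) → Set
AbsMonotone f = ∀ t s → 0ℤ ≤ Δⁿ t f s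

AbsMonotone-cong : ∀ {f g : ℕ → ℤ} → (∀ s → f s ≡ g s) → AbsMonotone f → AbsMonotone g
AbsMonotone-cong f≡g f⁺ t s = subst (0ℤ ≤_) (Δⁿ-cong t f≡g s) (f⁺ t s)

AbsMonotone-fromΔ : ∀ {f : ℕ → ℤ} → (∀ s → 0ℤ ≤ f s) → AbsMonotone (Δ f) → AbsMonotone f
AbsMonotone-fromΔ f≥0 Δf⁺ zero    = f≥0
AbsMonotone-fromΔ f≥0 Δf⁺ (suc t) = Δf⁺ t

AbsMonotone-zero : AbsMonotone (λ _ → 0ℤ)
AbsMonotone-zero t s = ℤP.≤-reflexive (sym (Δⁿ-zero t s))

AbsMonotone-const : ∀ {c} → 0ℤ ≤ c → AbsMonotone (λ _ → c)
AbsMonotone-const {c} c≥0 =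
  AbsMonotone-fromΔ (λ _ → c≥0) (AbsMonotone-cong (λ _ → sym (ℤP.+-inverseʳ c)) AbsMonotone-zero)

AbsMonotone-+ : ∀ {f g : ℕ → ℤ} → AbsMonotone f → AbsMonotone g → AbsMonotone (λ s → f s + g s)
AbsMonotone-+ {f} {g} f⁺ g⁺ t s =
  subst (0ℤ ≤_) (sym (Δⁿ-+ t f g s)) (ℤP.+-mono-≤ (f⁺ t s) (g⁺ t s))

AbsMonotone-shift : ∀ {f : ℕ → ℤ} → AbsMonotone f → AbsMonotone (λ s → f (suc s))
AbsMonotone-shift {f} f⁺ t s = subst (0ℤ ≤_) (sym (Δⁿ-shift t f s)) (f⁺ t (suc s))

Δ-* : ∀ (f g : ℕ → ℤ) s → Δ (λ s → f s * g s) s ≡ f (suc s) * Δ g s + Δ f s * g s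
Δ-* f g s = leibniz (f (suc s)) (g (suc s)) (f s) (g s)
  where
  leibniz : ∀ a b c d → a * b - c * d ≡ a * (b - d) + (a - c) * d
  leibniz = solve-∀

AbsMonotone-* : ∀ {f g : ℕ → ℤ} → AbsMonotone f → AbsMonotone g → AbsMonotone (λ s → f s * g s)
AbsMonotone-*         f⁺ g⁺ zero    s = 0≤i*j (f⁺ 0 s) (g⁺ 0 s)
AbsMonotone-* {f} {g} f⁺ g⁺ (suc t) s =
  subst (0ℤ ≤_) (sym (trans (Δⁿ-cong t (Δ-* f g) s) (Δⁿ-+ t _ _ s)))
    (ℤP.+-mono-≤ (AbsMonotone-* (AbsMonotone-shift f⁺) (λ t → g⁺ (suc t)) t s)
                 (AbsMonotone-* (λ t → f⁺ (suc t)) g⁺ t s))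

AbsMonotone-^ : ∀ {f : ℕ → ℤ} k → AbsMonotone f → AbsMonotone (λ s → f s ^ k)
AbsMonotone-^ zero    f⁺ = AbsMonotone-const (ℤ.+≤+ z≤n)
AbsMonotone-^ (suc k) f⁺ = AbsMonotone-* f⁺ (AbsMonotone-^ k f⁺)

AbsMonotone-^-gap : ∀ {f g : ℕ → ℤ} k → AbsMonotone f → AbsMonotone (λ s → g s - f s) →
                    AbsMonotone (λ s → g s ^ k - f s ^ k)
AbsMonotone-^-gap zero    f⁺ gap⁺ = AbsMonotone-zero
AbsMonotone-^-gap {f} {g} (suc k) f⁺ gap⁺ =
  AbsMonotone-cong (λ s → sym (split (g s) (f s) (g s ^ k) (f s ^ k)))
    (AbsMonotone-+ (AbsMonotone-* g⁺ (AbsMonotone-^-gap k f⁺ gap⁺))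
                   (AbsMonotone-* gap⁺ (AbsMonotone-^ k f⁺)))
  where
  split : ∀ x y X Y → x * X - y * Y ≡ x * (X - Y) + (x - y) * Y
  split = solve-∀
  g⁺ : AbsMonotone g
  g⁺ = AbsMonotone-cong (λ s → i+[j-i]≡j (f s) (g s)) (AbsMonotone-+ f⁺ gap⁺)

Δⁿ-mono : ∀ {f g : ℕ → ℤ} → AbsMonotone (λ s → g s - f s) → ∀ t s → Δⁿ t f s ≤ Δⁿ t g s
Δⁿ-mono {f} {g} gap⁺ t s = begin
  Δⁿ t f s                                   ≡⟨ sym (ℤP.+-identityʳ (Δⁿ t f s)) ⟩
  Δⁿ t f s + 0ℤ                              ≤⟨ ℤP.+-monoʳ-≤ (Δⁿ t f s) (gap⁺ t s) ⟩
  Δⁿ t f s + Δⁿ t (λ s → g s - f s) s        ≡⟨ sym (Δⁿ-+ t f _ s) ⟩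
  Δⁿ t (λ s → f s + (g s - f s)) s           ≡⟨ Δⁿ-cong t (λ s → i+[j-i]≡j (f s) (g s)) s ⟩
  Δⁿ t g s                                   ∎
  where
  open ℤP.≤-Reasoning

AbsMonotone-binomial : ∀ j → AbsMonotone (λ s → + (s C j))
AbsMonotone-binomial zero    = AbsMonotone-const (ℤ.+≤+ z≤n)
AbsMonotone-binomial (suc j) =
  AbsMonotone-fromΔ (λ _ → ℤ.+≤+ z≤n)
    (AbsMonotone-cong (λ s → sym (Δ-binomial s)) (AbsMonotone-binomial j))
  where
  Δ-binomial : ∀ s → Δ (λ s → + (s C suc j)) s ≡ + (s C j)
  Δ-binomial s = begin
    + (suc s C suc j) - + (s C suc j)
      ≡⟨ cong (λ c → + c - + (s C suc j)) (sym (nCk+nC[k+1]≡[n+1]C[k+1] s j)) ⟩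
    + (s C j ℕ.+ s C suc j) - + (s C suc j)
      ≡⟨ cong (_- + (s C suc j)) (ℤP.pos-+ (s C j) (s C suc j)) ⟩
    + (s C j) + + (s C suc j) - + (s C suc j)
      ≡⟨ i+j-j≡i (+ (s C j)) (+ (s C suc j)) ⟩
    + (s C j) ∎
    where
    open ≡-Reasoning

AbsMonotone-identity : AbsMonotone (λ s → + s)
AbsMonotone-identity = AbsMonotone-cong (λ s → cong +_ (nC1≡n s)) (AbsMonotone-binomial 1)

AbsMonotone-fallingFactorial : ∀ m → AbsMonotone (λ s → + (s P m))
AbsMonotone-fallingFactorial m =
  AbsMonotone-cong (λ s → trans (sym (ℤP.pos-* (s C m) (m !))) (cong +_ (nCk*k!≡nPk s m)))
    (AbsMonotone-* (AbsMonotone-binomial m) (AbsMonotone-const (ℤ.+≤+ z≤n)))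

AbsMonotone-power-gap : ∀ m → AbsMonotone (λ s → + (s ℕ.^ m) - + (s P m))
AbsMonotone-power-gap zero    = AbsMonotone-zero
AbsMonotone-power-gap (suc m) =
  AbsMonotone-cong (λ s → sym (recurrence s))
    (AbsMonotone-+ (AbsMonotone-* AbsMonotone-identity (AbsMonotone-power-gap m))
                   (AbsMonotone-* (AbsMonotone-const {+ m} (ℤ.+≤+ z≤n)) (AbsMonotone-fallingFactorial m)))
  where
  recurrence : ∀ s → + (s ℕ.^ suc m) - + (s P suc m) ≡ + s * (+ (s ℕ.^ m) - + (s P m)) + + m * + (s P m)
  recurrence s = begin
    + (s ℕ.^ suc m) - + (s P suc m)                       ≡⟨ cong₂ _-_ (ℤP.pos-* s (s ℕ.^ m)) falling ⟩
    + s * + (s ℕ.^ m) - (+ s * + (s P m) - + m * + (s P m)) ≡⟨ regroup (+ s) (+ (s ℕ.^ m)) (+ (s P m)) (+ m) ⟩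
    + s * (+ (s ℕ.^ m) - + (s P m)) + + m * + (s P m)     ∎
    where
    open ≡-Reasoning
    regroup : ∀ a x y b → a * x - (a * y - b * y) ≡ a * (x - y) + b * y
    regroup = solve-∀
    falling : + (s P suc m) ≡ + s * + (s P m) - + m * + (s P m)
    falling = begin
      + (s P suc m)                                 ≡⟨ sym (i+j-j≡i (+ (s P suc m)) (+ m * + (s P m))) ⟩
      + (s P suc m) + + m * + (s P m) - + m * + (s P m) ≡⟨ cong (_- + m * + (s P m)) (sym split) ⟩
      + s * + (s P m) - + m * + (s P m)             ∎
      where
      split : + s * + (s P m) ≡ + (s P suc m) + + m * + (s P m)
      split = begin
        + s * + (s P m)                     ≡⟨ sym (ℤP.pos-* s (s P m)) ⟩
        + (s ℕ.* (s P m))                   ≡⟨ cong +_ (n*nPk≡nP[1+k]+k*nPk s m) ⟩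
        + (s P suc m ℕ.+ m ℕ.* (s P m))     ≡⟨ ℤP.pos-+ (s P suc m) (m ℕ.* (s P m)) ⟩
        + (s P suc m) + + (m ℕ.* (s P m))   ≡⟨ cong (_+_ (+ (s P suc m))) (ℤP.pos-* m (s P m)) ⟩
        + (s P suc m) + + m * + (s P m)     ∎

-- The inequality between Q and R

power : ℕ → ℕ → ℕ → ℤ
power m k s = (+ (s ℕ.^ m)) ^ k

fallingPower : ℕ → ℕ → ℕ → ℤ
fallingPower m k s = (+ (s P m)) ^ k

Δⁿ-fallingPower≤Δⁿ-power : ∀ m k t s → Δⁿ t (fallingPower m k) s ≤ Δⁿ t (power m k) s
Δⁿ-fallingPower≤Δⁿ-power m k =
  Δⁿ-mono (AbsMonotone-^-gap k (AbsMonotone-fallingFactorial m) (AbsMonotone-power-gap m))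

R-as-Δⁿ : ∀ k m t → .{{ℕ.NonZero k}} → .{{ℕ.NonZero m}} → R k m t ≡ Δⁿ t (power m k) 0
R-as-Δⁿ k@(suc k-1) m@(suc m-1) t = sym (begin
  Δⁿ t (power m k) 0
    ≡⟨ Δⁿ-newton t (power m k) 0 ⟩
  sumℤ t (λ i → signedBinomial t i * power m k (t ∸ i)) + signedBinomial t t * power m k (t ∸ t)
    ≡⟨ cong₂ _+_ (sumℤ-cong t (λ i _ → term i)) last-vanishes ⟩
  R k m t + 0ℤ
    ≡⟨ ℤP.+-identityʳ (R k m t) ⟩
  R k m t ∎)
  where
  open ≡-Reasoning
  term : ∀ i → signedBinomial t i * power m k (t ∸ i) ≡ sgn i * + ((t C i) ℕ.* (t ∸ i) ℕ.^ (m ℕ.* k))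
  term i = begin
    sgn i * + (t C i) * (+ ((t ∸ i) ℕ.^ m)) ^ k
      ≡⟨ cong (sgn i * + (t C i) *_) (sym (pos-^ ((t ∸ i) ℕ.^ m) k)) ⟩
    sgn i * + (t C i) * + (((t ∸ i) ℕ.^ m) ℕ.^ k)
      ≡⟨ cong (λ x → sgn i * + (t C i) * + x) (ℕP.^-*-assoc (t ∸ i) m k) ⟩
    sgn i * + (t C i) * + ((t ∸ i) ℕ.^ (m ℕ.* k))
      ≡⟨ ℤP.*-assoc (sgn i) _ _ ⟩
    sgn i * (+ (t C i) * + ((t ∸ i) ℕ.^ (m ℕ.* k)))
      ≡⟨ cong (sgn i *_) (sym (ℤP.pos-* (t C i) _)) ⟩
    sgn i * + ((t C i) ℕ.* (t ∸ i) ℕ.^ (m ℕ.* k)) ∎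
  last-vanishes : signedBinomial t t * power m k (t ∸ t) ≡ 0ℤ
  last-vanishes = begin
    signedBinomial t t * power m k (t ∸ t)   ≡⟨ cong (λ x → signedBinomial t t * power m k x) (ℕP.n∸n≡0 t) ⟩
    signedBinomial t t * power m k 0         ≡⟨ cong (signedBinomial t t *_) power-at-0 ⟩
    signedBinomial t t * 0ℤ                  ≡⟨ ℤP.*-zeroʳ (signedBinomial t t) ⟩
    0ℤ                                       ∎
    where
    power-at-0 : power m k 0 ≡ 0ℤ
    power-at-0 = trans (cong (λ x → (+ x) ^ k) (ℕP.*-zeroˡ (0 ℕ.^ m-1))) (ℤP.*-zeroˡ ((+ 0) ^ k-1))

Q-as-Δⁿ : ∀ k m t → .{{ℕ.NonZero k}} → .{{ℕ.NonZero m}} →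
          Q k m t * + ((m !) ℕ.^ k) ≡ Δⁿ t (fallingPower m k) 0
Q-as-Δⁿ k@(suc k-1) m@(suc m-1) t = begin
  Q k m t * c
    ≡⟨ ℤP.*-comm (Q k m t) c ⟩
  c * Q k m t
    ≡⟨ sym (sumℤ-distribˡ-* N c _) ⟩
  sumℤ N (λ i → c * (sgn i * + ((t C i) ℕ.* ((t ∸ i) C m) ℕ.^ k)))
    ≡⟨ sumℤ-cong N (λ i _ → term i) ⟩
  sumℤ N a
    ≡⟨ sym (sumℤ-vanishing-tail (suc t ∸ N) N a a-vanishes) ⟩
  sumℤ (suc t ∸ N ℕ.+ N) a
    ≡⟨ cong (λ n → sumℤ n a) (ℕP.m∸n+n≡m (ℕP.m∸n≤m (suc t) m)) ⟩
  sumℤ (suc t) a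
    ≡⟨ sym (Δⁿ-newton t (fallingPower m k) 0) ⟩
  Δⁿ t (fallingPower m k) 0 ∎
  where
  open ≡-Reasoning
  c = + ((m !) ℕ.^ k)
  N = suc t ∸ m
  a : ℕ → ℤ
  a i = signedBinomial t i * fallingPower m k (t ∸ i)
  term : ∀ i → c * (sgn i * + ((t C i) ℕ.* ((t ∸ i) C m) ℕ.^ k)) ≡ a i
  term i = begin
    c * (sgn i * + ((t C i) ℕ.* B ℕ.^ k))
      ≡⟨ cong (λ x → c * (sgn i * x)) (ℤP.pos-* (t C i) (B ℕ.^ k)) ⟩
    c * (sgn i * (+ (t C i) * + (B ℕ.^ k)))
      ≡⟨ reassoc c (sgn i) (+ (t C i)) (+ (B ℕ.^ k)) ⟩
    sgn i * + (t C i) * (+ (B ℕ.^ k) * c)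
      ≡⟨ cong (sgn i * + (t C i) *_) (sym (ℤP.pos-* (B ℕ.^ k) ((m !) ℕ.^ k))) ⟩
    sgn i * + (t C i) * + (B ℕ.^ k ℕ.* (m !) ℕ.^ k) ≡⟨ cong (λ x → sgn i * + (t C i) * + x) (sym ([m*n]^k≡m^k*n^k B (m !) k)) ⟩
    sgn i * + (t C i) * + ((B ℕ.* m !) ℕ.^ k)
      ≡⟨ cong (λ x → sgn i * + (t C i) * + (x ℕ.^ k)) (nCk*k!≡nPk (t ∸ i) m) ⟩
    sgn i * + (t C i) * + (((t ∸ i) P m) ℕ.^ k)
      ≡⟨ cong (sgn i * + (t C i) *_) (pos-^ ((t ∸ i) P m) k) ⟩
    a i ∎
    where
    B = (t ∸ i) C m
    reassoc : ∀ c s x y → c * (s * (x * y)) ≡ s * x * (y * c)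
    reassoc = solve-∀
  a-vanishes : ∀ i → N ℕ.≤ i → a i ≡ 0ℤ
  a-vanishes i N≤i =
    trans (cong (λ x → signedBinomial t i * (+ x) ^ k) (Spec.k>n⇒nPk≡0 t∸i<m))
      (trans (cong (signedBinomial t i *_) (ℤP.*-zeroˡ ((+ 0) ^ k-1))) (ℤP.*-zeroʳ (signedBinomial t i)))
    where
    t∸i<m : t ∸ i ℕ.< m
    t∸i<m = s≤s (ℕP.m≤n+o⇒m∸n≤o t i
      (ℕP.≤-trans (ℕP.m≤n+m∸n t m-1)
        (ℕP.≤-trans (ℕP.+-monoʳ-≤ m-1 N≤i) (ℕP.≤-reflexive (ℕP.+-comm m-1 i)))))

Q*m!^k≤R : ∀ k m t → .{{ℕ.NonZero k}} → .{{ℕ.NonZero m}} → Q k m t * + ((m !) ℕ.^ k) ≤ R k m t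
Q*m!^k≤R k m t =
  subst₂ _≤_ (sym (Q-as-Δⁿ k m t)) (sym (R-as-Δⁿ k m t)) (Δⁿ-fallingPower≤Δⁿ-power m k t 0)

toℚᵘ-/ : ∀ a d → toℚᵘ (a ℚ./ suc d) ℚᵘ.≃ mkℚᵘ a d
toℚᵘ-/ a d = ℚP.toℚᵘ-fromℚᵘ (mkℚᵘ a d)

frac-*-≤ : ∀ a b c {d₁ d₂ d₃} → 1 ℕ.≤ d₁ → 1 ℕ.≤ d₂ → 1 ℕ.≤ d₃ →
           a * b * + d₃ ≤ c * (+ d₁ * + d₂) → frac a d₁ ℚ.* frac b d₂ ℚ.≤ frac c d₃
frac-*-≤ a b c {suc d₁} {suc d₂} {suc d₃} _ _ _ cross = ℚP.toℚᵘ-cancel-≤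
  (ℚᵘP.≤-respˡ-≃ (ℚᵘP.≃-sym (ℚᵘP.≃-trans (ℚP.toℚᵘ-homo-* (a ℚ./ suc d₁) (b ℚ./ suc d₂))
                                         (ℚᵘP.*-cong (toℚᵘ-/ a d₁) (toℚᵘ-/ b d₂))))
    (ℚᵘP.≤-respʳ-≃ (ℚᵘP.≃-sym (toℚᵘ-/ c d₃)) (ℚᵘ.*≤* cross)))

lhsFrac*Pdist≤rhsFrac : ∀ n m k t → 1 ℕ.≤ n → 1 ℕ.≤ m → 1 ℕ.≤ k → m ℕ.≤ n →
                        lhsFrac n m k t ℚ.* Pdist n m k ℚ.≤ rhsFrac n m k t
lhsFrac*Pdist≤rhsFrac n m@(suc _) k@(suc _) t 1≤n _ _ m≤n =
  frac-*-≤ _ _ _ (1≤m^n k (1≤nCk m≤n)) (1≤m^n (m ℕ.* k) 1≤n) (1≤m^n (k ℕ.* m) 1≤n) cross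
  where
  a = n C t
  c = (n C m) ℕ.^ k
  f = (m !) ℕ.^ k
  D = n ℕ.^ (m ℕ.* k)
  x = a ℕ.* c ℕ.* D
  +x≡ : + x ≡ + a * + c * + D
  +x≡ = trans (ℤP.pos-* (a ℕ.* c) D) (cong (_* + D) (ℤP.pos-* a c))
  Pᵏ≡c*f : (n P m) ℕ.^ k ≡ c ℕ.* f
  Pᵏ≡c*f = trans (cong (ℕ._^ k) (sym (nCk*k!≡nPk n m))) ([m*n]^k≡m^k*n^k (n C m) (m !) k)
  cross : (+ a * Q k m t) * + ((n P m) ℕ.^ k) * + (n ℕ.^ (k ℕ.* m)) ≤ (+ a * R k m t) * (+ c * + D)
  cross = begin
    (+ a * Q k m t) * + ((n P m) ℕ.^ k) * + (n ℕ.^ (k ℕ.* m))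
      ≡⟨ cong₂ (λ y z → (+ a * Q k m t) * + y * + (n ℕ.^ z)) Pᵏ≡c*f (ℕP.*-comm k m) ⟩
    (+ a * Q k m t) * + (c ℕ.* f) * + D
      ≡⟨ cong (λ y → (+ a * Q k m t) * y * + D) (ℤP.pos-* c f) ⟩
    (+ a * Q k m t) * (+ c * + f) * + D
      ≡⟨ trans (regroupˡ (+ a) (Q k m t) (+ c) (+ f) (+ D)) (cong (_* (Q k m t * + f)) (sym +x≡)) ⟩
    + x * (Q k m t * + f)
      ≤⟨ ℤP.*-monoˡ-≤-nonNeg (+ x) (Q*m!^k≤R k m t) ⟩
    + x * R k m t
      ≡⟨ trans (cong (_* R k m t) +x≡) (regroupʳ (+ a) (R k m t) (+ c) (+ D)) ⟩
    (+ a * R k m t) * (+ c * + D) ∎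
    where
    open ℤP.≤-Reasoning
    regroupˡ : ∀ a q c f d → (a * q) * (c * f) * d ≡ a * c * d * (q * f)
    regroupˡ = solve-∀
    regroupʳ : ∀ a r c d → a * c * d * r ≡ (a * r) * (c * d)
    regroupʳ = solve-∀

-- The distinctness probability P

-- n ^ k − n P k ≤ C(k,2) n ^ (k−1), with both sides multiplied by n
n*n^k≤n*nPk+kC2*n^k : ∀ n k → n ℕ.* n ℕ.^ k ℕ.≤ n ℕ.* (n P k) ℕ.+ (k C 2) ℕ.* n ℕ.^ k
n*n^k≤n*nPk+kC2*n^k n zero    = ℕP.≤-reflexive (sym (ℕP.+-identityʳ (n ℕ.* 1)))
n*n^k≤n*nPk+kC2*n^k n (suc k) = begin
  n ℕ.* (n ℕ.* X)
    ≤⟨ ℕP.*-monoʳ-≤ n (n*n^k≤n*nPk+kC2*n^k n k) ⟩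
  n ℕ.* (n ℕ.* Y ℕ.+ c ℕ.* X)
    ≡⟨ cong (λ z → n ℕ.* (z ℕ.+ c ℕ.* X)) (n*nPk≡nP[1+k]+k*nPk n k) ⟩
  n ℕ.* (n P suc k ℕ.+ k ℕ.* Y ℕ.+ c ℕ.* X)
    ≡⟨ expand n (n P suc k) k Y c X ⟩
  n ℕ.* (n P suc k) ℕ.+ k ℕ.* (n ℕ.* Y) ℕ.+ c ℕ.* (n ℕ.* X)
    ≤⟨ ℕP.+-monoˡ-≤ (c ℕ.* (n ℕ.* X))
         (ℕP.+-monoʳ-≤ (n ℕ.* (n P suc k)) (ℕP.*-monoʳ-≤ k (ℕP.*-monoʳ-≤ n (nPk≤n^k n k)))) ⟩
  n ℕ.* (n P suc k) ℕ.+ k ℕ.* (n ℕ.* X) ℕ.+ c ℕ.* (n ℕ.* X)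
    ≡⟨ collect (n ℕ.* (n P suc k)) k c (n ℕ.* X) ⟩
  n ℕ.* (n P suc k) ℕ.+ (k ℕ.+ c) ℕ.* (n ℕ.* X)
    ≡⟨ cong (λ z → n ℕ.* (n P suc k) ℕ.+ z ℕ.* (n ℕ.* X)) (sym ([1+k]C2≡k+kC2 k)) ⟩
  n ℕ.* (n P suc k) ℕ.+ (suc k C 2) ℕ.* (n ℕ.* X) ∎
  where
  open ℕP.≤-Reasoning
  X = n ℕ.^ k
  Y = n P k
  c = k C 2
  expand : ∀ n p k y c x →
           n ℕ.* (p ℕ.+ k ℕ.* y ℕ.+ c ℕ.* x) ≡ n ℕ.* p ℕ.+ k ℕ.* (n ℕ.* y) ℕ.+ c ℕ.* (n ℕ.* x)
  expand = ℕSolver.solve-∀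
  collect : ∀ a k c z → a ℕ.+ k ℕ.* z ℕ.+ c ℕ.* z ≡ a ℕ.+ (k ℕ.+ c) ℕ.* z
  collect = ℕSolver.solve-∀

n*X^k≤n*Y^k+k*c*X^k : ∀ n {X Y c} → Y ℕ.≤ X → n ℕ.* X ℕ.≤ n ℕ.* Y ℕ.+ c ℕ.* X →
                      ∀ k → n ℕ.* X ℕ.^ k ℕ.≤ n ℕ.* Y ℕ.^ k ℕ.+ k ℕ.* c ℕ.* X ℕ.^ k
n*X^k≤n*Y^k+k*c*X^k n {X} {Y} {c} Y≤X nX≤nY+cX zero = ℕP.≤-reflexive (sym (ℕP.+-identityʳ (n ℕ.* 1)))
n*X^k≤n*Y^k+k*c*X^k n {X} {Y} {c} Y≤X nX≤nY+cX (suc k) = begin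
  n ℕ.* (X ℕ.* X ℕ.^ k)
    ≡⟨ shuffle₁ n X (X ℕ.^ k) ⟩
  X ℕ.* (n ℕ.* X ℕ.^ k)
    ≤⟨ ℕP.*-monoʳ-≤ X (n*X^k≤n*Y^k+k*c*X^k n Y≤X nX≤nY+cX k) ⟩
  X ℕ.* (n ℕ.* Y ℕ.^ k ℕ.+ k ℕ.* c ℕ.* X ℕ.^ k)
    ≡⟨ shuffle₂ X n (Y ℕ.^ k) k c (X ℕ.^ k) ⟩
  n ℕ.* X ℕ.* Y ℕ.^ k ℕ.+ k ℕ.* c ℕ.* (X ℕ.* X ℕ.^ k)
    ≤⟨ ℕP.+-monoˡ-≤ (k ℕ.* c ℕ.* (X ℕ.* X ℕ.^ k)) (ℕP.*-monoˡ-≤ (Y ℕ.^ k) nX≤nY+cX) ⟩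
  (n ℕ.* Y ℕ.+ c ℕ.* X) ℕ.* Y ℕ.^ k ℕ.+ k ℕ.* c ℕ.* (X ℕ.* X ℕ.^ k)
    ≡⟨ shuffle₃ n Y c X (Y ℕ.^ k) k (X ℕ.* X ℕ.^ k) ⟩
  n ℕ.* (Y ℕ.* Y ℕ.^ k) ℕ.+ c ℕ.* (X ℕ.* Y ℕ.^ k) ℕ.+ k ℕ.* c ℕ.* (X ℕ.* X ℕ.^ k)
    ≤⟨ ℕP.+-monoˡ-≤ (k ℕ.* c ℕ.* (X ℕ.* X ℕ.^ k))
         (ℕP.+-monoʳ-≤ (n ℕ.* (Y ℕ.* Y ℕ.^ k)) (ℕP.*-monoʳ-≤ c (ℕP.*-monoʳ-≤ X (ℕP.^-monoˡ-≤ k Y≤X)))) ⟩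
  n ℕ.* (Y ℕ.* Y ℕ.^ k) ℕ.+ c ℕ.* (X ℕ.* X ℕ.^ k) ℕ.+ k ℕ.* c ℕ.* (X ℕ.* X ℕ.^ k)
    ≡⟨ shuffle₄ n (Y ℕ.* Y ℕ.^ k) c (X ℕ.* X ℕ.^ k) k ⟩
  n ℕ.* (Y ℕ.* Y ℕ.^ k) ℕ.+ suc k ℕ.* c ℕ.* (X ℕ.* X ℕ.^ k) ∎
  where
  open ℕP.≤-Reasoning
  shuffle₁ : ∀ n X a → n ℕ.* (X ℕ.* a) ≡ X ℕ.* (n ℕ.* a)
  shuffle₁ = ℕSolver.solve-∀
  shuffle₂ : ∀ X n a k c b →
             X ℕ.* (n ℕ.* a ℕ.+ k ℕ.* c ℕ.* b) ≡ n ℕ.* X ℕ.* a ℕ.+ k ℕ.* c ℕ.* (X ℕ.* b)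
  shuffle₂ = ℕSolver.solve-∀
  shuffle₃ : ∀ n Y c X a k b → (n ℕ.* Y ℕ.+ c ℕ.* X) ℕ.* a ℕ.+ k ℕ.* c ℕ.* b ≡
                               n ℕ.* (Y ℕ.* a) ℕ.+ c ℕ.* (X ℕ.* a) ℕ.+ k ℕ.* c ℕ.* b
  shuffle₃ = ℕSolver.solve-∀
  shuffle₄ : ∀ n a c b k →
             n ℕ.* a ℕ.+ c ℕ.* b ℕ.+ k ℕ.* c ℕ.* b ≡ n ℕ.* a ℕ.+ (1 ℕ.+ k) ℕ.* c ℕ.* b
  shuffle₄ = ℕSolver.solve-∀

[n^mk∸nPm^k]*n≤k*mC2*n^mk : ∀ n m k →
  (n ℕ.^ (m ℕ.* k) ∸ (n P m) ℕ.^ k) ℕ.* n ℕ.≤ (k ℕ.* (m C 2)) ℕ.* n ℕ.^ (m ℕ.* k)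
[n^mk∸nPm^k]*n≤k*mC2*n^mk n m k rewrite sym (ℕP.^-*-assoc n m k) = begin
  (X ℕ.^ k ∸ Y ℕ.^ k) ℕ.* n          ≡⟨ ℕP.*-distribʳ-∸ n (X ℕ.^ k) (Y ℕ.^ k) ⟩
  X ℕ.^ k ℕ.* n ∸ Y ℕ.^ k ℕ.* n      ≤⟨ ℕP.m≤n+o⇒m∸n≤o (X ℕ.^ k ℕ.* n) (Y ℕ.^ k ℕ.* n) bernoulli ⟩
  k ℕ.* (m C 2) ℕ.* X ℕ.^ k          ∎
  where
  open ℕP.≤-Reasoning
  X = n ℕ.^ m
  Y = n P m
  bernoulli : X ℕ.^ k ℕ.* n ℕ.≤ Y ℕ.^ k ℕ.* n ℕ.+ k ℕ.* (m C 2) ℕ.* X ℕ.^ k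
  bernoulli = subst₂ ℕ._≤_
    (ℕP.*-comm n (X ℕ.^ k)) (cong (ℕ._+ k ℕ.* (m C 2) ℕ.* X ℕ.^ k) (ℕP.*-comm n (Y ℕ.^ k)))
    (n*X^k≤n*Y^k+k*c*X^k n (nPk≤n^k n m) (n*n^k≤n*nPk+kC2*n^k n m) k)

toℚᵘ-∣/-q∣ : ∀ a d q → toℚᵘ ℚ.∣ (a ℚ./ suc d) ℚ.- q ∣ ℚᵘ.≃ ℚᵘ.∣ mkℚᵘ a d ℚᵘ.- toℚᵘ q ∣
toℚᵘ-∣/-q∣ a d q = ℚᵘP.≃-trans (ℚP.toℚᵘ-homo-∣-∣ ((a ℚ./ suc d) ℚ.- q)) (ℚᵘP.∣-∣-cong
  (ℚᵘP.≃-trans (ℚP.toℚᵘ-homo-+ (a ℚ./ suc d) (ℚ.- q))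
    (ℚᵘP.≃-trans (ℚᵘP.+-congʳ (toℚᵘ (a ℚ./ suc d)) (ℚP.toℚᵘ-homo‿- q))
                 (ℚᵘP.+-congˡ (ℚᵘ.- toℚᵘ q) (toℚᵘ-/ a d)))))

∣frac-1∣≤∣frac-0∣ : ∀ y c {D E} → 1 ℕ.≤ D → 1 ℕ.≤ E → y ℕ.≤ D → (D ∸ y) ℕ.* E ℕ.≤ c ℕ.* D →
                    ℚ.∣ frac (+ y) D ℚ.- 1ℚ ∣ ℚ.≤ ℚ.∣ frac (+ c) E ℚ.- 0ℚ ∣
∣frac-1∣≤∣frac-0∣ y c {suc d} {suc e} _ _ y≤D cross = ℚP.toℚᵘ-cancel-≤
  (ℚᵘP.≤-respˡ-≃ (ℚᵘP.≃-sym (toℚᵘ-∣/-q∣ (+ y) d 1ℚ)) (ℚᵘP.≤-respʳ-≃ (ℚᵘP.≃-sym (toℚᵘ-∣/-q∣ (+ c) e 0ℚ))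
    (ℚᵘ.*≤* (subst₂ _≤_ (sym lhs) (sym rhs)
      (subst₂ _≤_ (ℤP.pos-* (suc d ∸ y) (suc e)) (ℤP.pos-* c (suc d)) (ℤ.+≤+ cross))))))
  where
  -- the numerators and denominators that ℚᵘ's _-_, ∣_∣ and _≤_ compute
  lhs : + ℤ.∣ + y * + 1 + - + 1 * + suc d ∣ * + suc (e ℕ.* 1) ≡ + (suc d ∸ y) * + suc e
  lhs = cong₂ _*_ (trans (cong (λ z → + ℤ.∣ z ∣) (minus (+ y) (+ suc d)))
                         (trans (ℤP.∣-∣-≤ (ℤ.+≤+ y≤D)) (trans (ℤP.m-n≡m⊖n (suc d) y) (ℤP.⊖-≥ y≤D))))
                  (cong (λ z → + suc z) (ℕP.*-identityʳ e))
    where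
    minus : ∀ a b → a * + 1 + - + 1 * b ≡ a - b
    minus = solve-∀
  rhs : + ℤ.∣ + c * + 1 + - 0ℤ * + suc e ∣ * + suc (d ℕ.* 1) ≡ + c * + suc d
  rhs = cong₂ _*_ (cong (λ z → + ℤ.∣ z ∣) (drop (+ c) (+ suc e))) (cong (λ z → + suc z) (ℕP.*-identityʳ d))
    where
    drop : ∀ a b → a * + 1 + - 0ℤ * b ≡ a
    drop = solve-∀

∣Pdist-1∣≤k*mC2/n : ∀ n m k → 1 ℕ.≤ n →
                    ℚ.∣ Pdist n m k ℚ.- 1ℚ ∣ ℚ.≤ ℚ.∣ frac (+ (k ℕ.* (m C 2))) n ℚ.- 0ℚ ∣
∣Pdist-1∣≤k*mC2/n n m k 1≤n = ∣frac-1∣≤∣frac-0∣ _ _ (1≤m^n (m ℕ.* k) 1≤n) 1≤n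
  (subst ((n P m) ℕ.^ k ℕ.≤_) (ℕP.^-*-assoc n m k) (ℕP.^-monoˡ-≤ k (nPk≤n^k n m)))
  ([n^mk∸nPm^k]*n≤k*mC2*n^mk n m k)

theorem2 : (n m k : ℕ → ℕ) →
    (∀ j → 1 ℕ.≤ n j) → (∀ j → 1 ℕ.≤ m j) → (∀ j → 1 ℕ.≤ k j) → (∀ j → m j ℕ.≤ n j) →
    TendsToInfty n → TendsToInfty m → TendsToInfty k →
    TendsTo (λ j → frac (+ (k j ℕ.* (m j C 2))) (n j)) 0ℚ →
    (∀ j (t : ℕ) → 1 ℕ.≤ t → t ℕ.≤ n j →
      lhsFrac (n j) (m j) (k j) t ℚ.* Pdist (n j) (m j) (k j)
        ℚ.≤ rhsFrac (n j) (m j) (k j) t)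
    × TendsTo (λ j → Pdist (n j) (m j) (k j)) 1ℚ
theorem2 n m k 1≤n 1≤m 1≤k m≤n _ _ _ k·mC2/n→0 = inequality , P→1
  where
  inequality : ∀ j t → 1 ℕ.≤ t → t ℕ.≤ n j →
               lhsFrac (n j) (m j) (k j) t ℚ.* Pdist (n j) (m j) (k j) ℚ.≤ rhsFrac (n j) (m j) (k j) t
  inequality j t _ _ = lhsFrac*Pdist≤rhsFrac (n j) (m j) (k j) t (1≤n j) (1≤m j) (1≤k j) (m≤n j)
  P→1 : TendsTo (λ j → Pdist (n j) (m j) (k j)) 1ℚ
  P→1 ε ε>0 with k·mC2/n→0 ε ε>0
  ... | J , close = J , λ j J≤j → ℚP.≤-<-trans (∣Pdist-1∣≤k*mC2/n (n j) (m j) (k j) (1≤n j)) (close j J≤j)
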